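{- Let $k>1$. Then the graph $ST^2_k$ has an efficient coloring whose vertex color classes are the sets $\Sigma_i^k$, $i=1,\ldots,2k-1$: that is, there is a total coloring of $ST^2_k$ with the $2k-1$ colors $\{1,\ldots,2k-1\}$ in which each vertex of $\Sigma_i^k$ receives color $i$, and such that for every vertex $v$, the vertex $v$ together with its $2k-2$ neighbors receive pairwise distinct colors, thus all $2k-1$ colors.
   Context: $ST^2_k$ has as vertices all strings $v_0v_1\cdots v_{2k-1}$ over $\{0,\ldots,k-1\}$ in which each symbol occurs exactly twice; $v,w$ are adjacent iff $w$ arises from $v$ by swapping $v_0$ with some $v_j$ ($1\le j\le 2k-1$) with $v_j\neq v_0$. It is $(2k-2)$-regular. For $i\in\{1,\ldots,2k-1\}$, $\Sigma_i^k$ is the set of vertices $v$ with $v_i=v_0$. A total coloring assigns colors to vertices and edges so that adjacent vertices, edges sharing an endpoint, and an edge and its endpoints get different colors; for a $d$-regular graph, a total coloring with $d+1$ colors is efficient if each vertex and its neighbors receive all $d+1$ colors. -}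

module Defs where

open import Data.Nat using (ℕ; suc; _*_; _<_)
open import Data.Fin using (Fin; zero)
open import Data.Fin.Properties using (_≟_)
open import Data.Vec using (Vec; lookup; count; _[_]≔_)
open import Data.Product using (Σ; _×_; ∃)
open import Data.Sum using (_⊎_)
open import Relation.Binary.PropositionalEquality using (_≡_; _≢_)

-- Convention: the parameter m stands for k - 1, i.e. k = suc m
-- (so that position 0 of a string of length 2k exists definitionally).
-- Strings of length 2k over the alphabet {0,…,k-1}.
Str : ℕ → Set
Str m = Vec (Fin (suc m)) (2 * suc m)

IsVertex : (m : ℕ) → Str m → Set
IsVertex m v = ∀ (x : Fin (suc m)) → count (_≟ x) v ≡ 2

swap0 : {m : ℕ} → Str m → Fin (2 * suc m) → Str m
swap0 v j = (v [ zero ]≔ lookup v j) [ j ]≔ lookup v zero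

Adj : (m : ℕ) → Str m → Str m → Set
Adj m v w = Σ (Fin (2 * suc m)) λ j → (lookup v j ≢ lookup v zero) × (w ≡ swap0 v j)

InSigma : (m : ℕ) → Fin (2 * suc m) → Str m → Set
InSigma m i v = lookup v i ≡ lookup v zero

-- Colors are elements of Fin (2k) different from zero, i.e. {1,…,2k-1}.
Color : ℕ → Set
Color m = Fin (2 * suc m)

-- Total coloring of ST²_k with colors {1,…,2k-1}; vertex colors vc,
-- edge colors ec given on (directed) adjacency witnesses, required to
-- depend only on the unordered edge {v,w}.
record IsTotalColoring (m : ℕ) (vc : Str m → Color m)
       (ec : (v w : Str m) → Adj m v w → Color m) : Set where
  field
    edge-well-defined : ∀ v w → IsVertex m v → IsVertex m w →
      (a : Adj m v w) (b : Adj m w v) → ec v w a ≡ ec w v b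
    vertex-color-range : ∀ v → IsVertex m v → vc v ≢ zero
    edge-color-range : ∀ v w → IsVertex m v → IsVertex m w →
      (a : Adj m v w) → ec v w a ≢ zero
    adjacent-vertices : ∀ v w → IsVertex m v → IsVertex m w →
      Adj m v w → vc v ≢ vc w
    incident-edges : ∀ v w u → IsVertex m v → IsVertex m w → IsVertex m u →
      (a : Adj m v w) (b : Adj m v u) → w ≢ u → ec v w a ≢ ec v u b
    edge-endpoint₁ : ∀ v w → IsVertex m v → IsVertex m w →
      (a : Adj m v w) → ec v w a ≢ vc v
    edge-endpoint₂ : ∀ v w → IsVertex m v → IsVertex m w →
      (a : Adj m v w) → ec v w a ≢ vc w

record IsEfficient (m : ℕ) (vc : Str m → Color m) : Set where
  field
    neighbours-distinct : ∀ v w u → IsVertex m v → IsVertex m w → IsVertex m u →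
      Adj m v w → Adj m v u → w ≢ u → vc w ≢ vc u
    all-colors : ∀ v → IsVertex m v → ∀ (c : Color m) → c ≢ zero →
      (vc v ≡ c) ⊎ ∃ λ w → IsVertex m w × Adj m v w × vc w ≡ c

-- Colour a vertex v by the position of the other occurrence of v₀ (so Σᵢ is
-- the class of colour i) and the edge from v to swap0 v j by j. The neighbour
-- swap0 v j starts with v_j, so its colour is the position q ∉ {0, j} of the
-- other occurrence of v_j in v. As every symbol occurs exactly twice, q
-- determines j: distinct neighbours get distinct colours, none equal to the
-- colour of v, and a colour c is either that of v (when v_c = v₀) or that of
-- the neighbour obtained by swapping at the other occurrence of v_c. Edge
-- colours are well defined since an edge can only be swapped back at the
-- position it was swapped at.
module Submission where

open import Defs
open import Data.Nat using (ℕ; suc; _+_; _*_; _<_)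
open import Data.Nat.Properties using (+-cancelʳ-≡; suc-injective; +-commutativeSemigroup)
open import Algebra.Properties.CommutativeSemigroup +-commutativeSemigroup using (xy∙z≈zy∙x)
open import Data.Fin using (Fin; zero; suc; punchIn; punchOut)
open import Data.Fin.Properties
  using (_≟_; any?; punchInᵢ≢i; punchOut-punchIn; punchOut-injective)
open import Data.Vec using (Vec; _∷_; [_]; lookup; count; removeAt; _[_]≔_)
open import Data.Vec.Properties using (lookup∘update; lookup∘update′; removeAt-punchOut)
open import Data.Product using (Σ; _×_; _,_; proj₁; proj₂; ∃)
open import Data.Sum using (_⊎_; inj₁; inj₂)
open import Function using (_∘_)
open import Relation.Nullary using (yes; no; ¬_; contradiction)
open import Relation.Unary using (Pred; Decidable)
open import Relation.Binary.PropositionalEquality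
  using (_≡_; _≢_; refl; sym; trans; cong; subst; module ≡-Reasoning)

open ≡-Reasoning

lookup∘removeAt : ∀ {a} {A : Set a} {n} (v : Vec A (suc n)) (p : Fin (suc n)) (i : Fin n) →
                  lookup (removeAt v p) i ≡ lookup v (punchIn p i)
lookup∘removeAt v p i = trans (cong (lookup (removeAt v p)) (sym (punchOut-punchIn p)))
                              (removeAt-punchOut v (punchInᵢ≢i p i ∘ sym))

module _ {a ℓ} {A : Set a} {P : Pred A ℓ} (P? : Decidable P) where

  count-∷ : ∀ {n} (x : A) (xs : Vec A n) → count P? (x ∷ xs) ≡ count P? [ x ] + count P? xs
  count-∷ x xs with P? x
  ... | yes _ = refl
  ... | no _  = refl

  count-[]≔ : ∀ {n} (v : Vec A n) (p : Fin n) (y : A) →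
              count P? (v [ p ]≔ y) + count P? [ lookup v p ] ≡ count P? v + count P? [ y ]
  count-[]≔ (x ∷ xs) zero y = begin
    count P? (y ∷ xs) + count P? [ x ]               ≡⟨ cong (_+ count P? [ x ]) (count-∷ y xs) ⟩
    count P? [ y ] + count P? xs + count P? [ x ]    ≡⟨ xy∙z≈zy∙x (count P? [ y ]) _ _ ⟩
    count P? [ x ] + count P? xs + count P? [ y ]    ≡⟨ cong (_+ count P? [ y ]) (count-∷ x xs) ⟨
    count P? (x ∷ xs) + count P? [ y ]               ∎
  count-[]≔ (x ∷ xs) (suc p) y with P? x
  ... | yes _ = cong suc (count-[]≔ xs p y)
  ... | no _  = count-[]≔ xs p y

  count≡suc⇒∃ : ∀ {n k} (v : Vec A n) → count P? v ≡ suc k → ∃ λ i → P (lookup v i)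
  count≡suc⇒∃ (x ∷ xs) eq with P? x
  ... | yes px = zero , px
  ... | no _ with count≡suc⇒∃ xs eq
  ...   | i , pi = suc i , pi

  count≡0⇒¬P : ∀ {n} (v : Vec A n) (i : Fin n) → count P? v ≡ 0 → ¬ P (lookup v i)
  count≡0⇒¬P (x ∷ xs) zero eq px with P? x
  ... | yes _   = contradiction eq λ ()
  ... | no ¬px  = ¬px px
  count≡0⇒¬P (x ∷ xs) (suc i) eq pi with P? x
  ... | yes _ = contradiction eq λ ()
  ... | no _  = count≡0⇒¬P xs i eq pi

  count-removeAt : ∀ {n} (v : Vec A (suc n)) (p : Fin (suc n)) → P (lookup v p) →
                   count P? v ≡ suc (count P? (removeAt v p))
  count-removeAt (x ∷ xs) zero px with P? x
  ... | yes _  = refl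
  ... | no ¬px = contradiction px ¬px
  count-removeAt (x ∷ xs@(_ ∷ _)) (suc p) pp with P? x
  ... | yes _ = cong suc (count-removeAt xs p pp)
  ... | no _  = count-removeAt xs p pp

  count≡1⇒unique : ∀ {n} (v : Vec A n) {p q} → count P? v ≡ 1 →
                   P (lookup v p) → P (lookup v q) → p ≡ q
  count≡1⇒unique {suc _} v {p} {q} eq pp pq with p ≟ q
  ... | yes p≡q = p≡q
  ... | no p≢q  = contradiction (subst P (sym (removeAt-punchOut v p≢q)) pq)
                    (count≡0⇒¬P (removeAt v p) (punchOut p≢q)
                      (suc-injective (trans (sym (count-removeAt v p pp)) eq)))

  count≡2⇒other : ∀ {n} (v : Vec A (suc n)) {p} → count P? v ≡ 2 → P (lookup v p) →
                  ∃ λ q → q ≢ p × P (lookup v q)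
  count≡2⇒other v {p} eq pp
    with count≡suc⇒∃ (removeAt v p) (suc-injective (trans (sym (count-removeAt v p pp)) eq))
  ... | i , pi = punchIn p i , punchInᵢ≢i p i , subst P (lookup∘removeAt v p i) pi

  count≡2⇒other-unique : ∀ {n} (v : Vec A (suc n)) {p q r} → count P? v ≡ 2 →
                         p ≢ q → p ≢ r → P (lookup v p) → P (lookup v q) → P (lookup v r) → q ≡ r
  count≡2⇒other-unique v {p} eq p≢q p≢r pp pq pr =
    punchOut-injective p≢q p≢r
      (count≡1⇒unique (removeAt v p)
        (suc-injective (trans (sym (count-removeAt v p pp)) eq))
        (subst P (sym (removeAt-punchOut v p≢q)) pq)
        (subst P (sym (removeAt-punchOut v p≢r)) pr))

Position : ℕ → Set
Position m = Fin (2 * suc m)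

module _ {m : ℕ} where

  lookup∘swap0-target : (v : Str m) (j : Position m) → lookup (swap0 v j) j ≡ lookup v zero
  lookup∘swap0-target v j = lookup∘update j (v [ zero ]≔ lookup v j) (lookup v zero)

  lookup∘swap0-zero : (v : Str m) {j : Position m} → j ≢ zero →
                      lookup (swap0 v j) zero ≡ lookup v j
  lookup∘swap0-zero v {j} j≢0 =
    trans (lookup∘update′ (j≢0 ∘ sym) (v [ zero ]≔ lookup v j) (lookup v zero))
          (lookup∘update zero v (lookup v j))

  lookup∘swap0-other : (v : Str m) {j k : Position m} → k ≢ zero → k ≢ j →
                       lookup (swap0 v j) k ≡ lookup v k
  lookup∘swap0-other v {j} k≢0 k≢j =
    trans (lookup∘update′ k≢j (v [ zero ]≔ lookup v j) (lookup v zero))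
          (lookup∘update′ k≢0 v (lookup v j))

  count-swap0 : ∀ {ℓ} {P : Pred (Fin (suc m)) ℓ} (P? : Decidable P) (v : Str m) (j : Position m) →
                count P? (swap0 v j) ≡ count P? v
  count-swap0 P? v j = +-cancelʳ-≡ (count P? [ lookup v j ]) _ _ (begin
    count P? (swap0 v j) + count P? [ lookup v j ]
      ≡⟨ cong (λ x → count P? (swap0 v j) + count P? [ x ]) v′ⱼ≡vⱼ ⟨
    count P? (swap0 v j) + count P? [ lookup v′ j ]
      ≡⟨ count-[]≔ P? v′ j (lookup v zero) ⟩
    count P? v′ + count P? [ lookup v zero ]
      ≡⟨ count-[]≔ P? v zero (lookup v j) ⟩
    count P? v + count P? [ lookup v j ]
      ∎)
    where
    v′ : Str m
    v′ = v [ zero ]≔ lookup v j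
    v′ⱼ≡vⱼ : lookup v′ j ≡ lookup v j
    v′ⱼ≡vⱼ with j ≟ zero
    ... | yes refl = lookup∘update zero v (lookup v j)
    ... | no j≢0   = lookup∘update′ j≢0 v (lookup v j)

  IsVertex-swap0 : (v : Str m) → IsVertex m v → (j : Position m) → IsVertex m (swap0 v j)
  IsVertex-swap0 v iv j x = trans (count-swap0 (_≟ x) v j) (iv x)

  moved⇒≢zero : (v : Str m) {j : Position m} → lookup v j ≢ lookup v zero → j ≢ zero
  moved⇒≢zero _ vⱼ≢v₀ refl = vⱼ≢v₀ refl

  swap0-reversed⇒same-position : {v : Str m} {j j′ : Position m} → lookup v j ≢ lookup v zero →
                                 v ≡ swap0 (swap0 v j) j′ → j ≡ j′
  swap0-reversed⇒same-position {v} {j} {j′} vⱼ≢v₀ v≡ww with j ≟ j′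
  ... | yes j≡j′ = j≡j′
  ... | no j≢j′  = contradiction (begin
    lookup v j                         ≡⟨ cong (λ u → lookup u j) v≡ww ⟩
    lookup (swap0 (swap0 v j) j′) j
      ≡⟨ lookup∘swap0-other (swap0 v j) (moved⇒≢zero v vⱼ≢v₀) j≢j′ ⟩
    lookup (swap0 v j) j               ≡⟨ lookup∘swap0-target v j ⟩
    lookup v zero                      ∎) vⱼ≢v₀

  -- The zero branch is a junk value: on vertices the search always succeeds.
  partner : Str m → Color m
  partner (x ∷ xs) with any? (λ q → lookup xs q ≟ x)
  ... | yes (q , _) = suc q
  ... | no _        = zero

  partner-spec : (v : Str m) → IsVertex m v → partner v ≢ zero × InSigma m (partner v) v
  partner-spec (x ∷ xs) iv with any? (λ q → lookup xs q ≟ x)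
  ... | yes (q , xs[q]≡x) = (λ ()) , xs[q]≡x
  ... | no ∄ with count≡2⇒other (_≟ x) (x ∷ xs) (iv x) refl
  ...   | zero  , 0≢0 , _     = contradiction refl 0≢0
  ...   | suc q , _ , xs[q]≡x = contradiction (q , xs[q]≡x) ∄

  partner≢zero : (v : Str m) → IsVertex m v → partner v ≢ zero
  partner≢zero v iv = proj₁ (partner-spec v iv)

  InSigma-partner : (v : Str m) → IsVertex m v → InSigma m (partner v) v
  InSigma-partner v iv = proj₂ (partner-spec v iv)

  partner-unique : (v : Str m) → IsVertex m v → {i : Position m} → i ≢ zero → InSigma m i v →
                   partner v ≡ i
  partner-unique v iv i≢0 vᵢ≡v₀ =
    count≡2⇒other-unique (_≟ lookup v zero) v (iv (lookup v zero))
      (partner≢zero v iv ∘ sym) (i≢0 ∘ sym) refl (InSigma-partner v iv) vᵢ≡v₀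

  partner-swap0≢ : (v : Str m) → IsVertex m v → {j : Position m} → lookup v j ≢ lookup v zero →
                   partner (swap0 v j) ≢ j
  partner-swap0≢ v iv {j} vⱼ≢v₀ p≡j = vⱼ≢v₀ (begin
    lookup v j            ≡⟨ lookup∘swap0-zero v (moved⇒≢zero v vⱼ≢v₀) ⟨
    lookup w zero         ≡⟨ InSigma-partner w (IsVertex-swap0 v iv j) ⟨
    lookup w (partner w)  ≡⟨ cong (lookup w) p≡j ⟩
    lookup w j            ≡⟨ lookup∘swap0-target v j ⟩
    lookup v zero         ∎)
    where
    w : Str m
    w = swap0 v j

  lookup-partner-swap0 : (v : Str m) → IsVertex m v → {j : Position m} →
                         lookup v j ≢ lookup v zero → lookup v (partner (swap0 v j)) ≡ lookup v j
  lookup-partner-swap0 v iv {j} vⱼ≢v₀ = begin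
    lookup v (partner w)  ≡⟨ lookup∘swap0-other v (partner≢zero w iw) (partner-swap0≢ v iv vⱼ≢v₀) ⟨
    lookup w (partner w)  ≡⟨ InSigma-partner w iw ⟩
    lookup w zero         ≡⟨ lookup∘swap0-zero v (moved⇒≢zero v vⱼ≢v₀) ⟩
    lookup v j            ∎
    where
    w : Str m
    w = swap0 v j
    iw : IsVertex m w
    iw = IsVertex-swap0 v iv j

  edgeColour : (v w : Str m) → Adj m v w → Color m
  edgeColour _ _ (j , _) = j

  edgeColour-symmetric : (v w : Str m) (a : Adj m v w) (b : Adj m w v) →
                         edgeColour v w a ≡ edgeColour w v b
  edgeColour-symmetric v _ (_ , vⱼ≢v₀ , refl) (_ , _ , v≡ww) =
    swap0-reversed⇒same-position {v} vⱼ≢v₀ v≡ww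

  edgeColour-injective : (v : Str m) {w u : Str m} (a : Adj m v w) (b : Adj m v u) →
                         edgeColour v w a ≡ edgeColour v u b → w ≡ u
  edgeColour-injective v (_ , _ , refl) (_ , _ , refl) = cong (swap0 v)

  edgeColour≢partner-source : (v : Str m) → IsVertex m v → {w : Str m} (a : Adj m v w) →
                              edgeColour v w a ≢ partner v
  edgeColour≢partner-source v iv (_ , vⱼ≢v₀ , refl) j≡p =
    vⱼ≢v₀ (trans (cong (lookup v) j≡p) (InSigma-partner v iv))

  edgeColour≢partner-target : (v : Str m) → IsVertex m v → {w : Str m} (a : Adj m v w) →
                              edgeColour v w a ≢ partner w
  edgeColour≢partner-target v iv (_ , vⱼ≢v₀ , refl) j≡p = partner-swap0≢ v iv vⱼ≢v₀ (sym j≡p)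

  partner-adjacent-≢ : (v : Str m) → IsVertex m v → {w : Str m} → Adj m v w → partner v ≢ partner w
  partner-adjacent-≢ v iv (j , vⱼ≢v₀ , refl) p≡p′ = vⱼ≢v₀ (begin
    lookup v j                       ≡⟨ lookup-partner-swap0 v iv vⱼ≢v₀ ⟨
    lookup v (partner (swap0 v j))   ≡⟨ cong (lookup v) p≡p′ ⟨
    lookup v (partner v)             ≡⟨ InSigma-partner v iv ⟩
    lookup v zero                    ∎)

  partner-neighbours-≢ : (v : Str m) → IsVertex m v → {w u : Str m} → Adj m v w → Adj m v u →
                         w ≢ u → partner w ≢ partner u
  partner-neighbours-≢ v iv a@(j , vⱼ≢v₀ , refl) b@(j′ , vⱼ′≢v₀ , refl) w≢u p≡p′ =
    w≢u (edgeColour-injective v a b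
      (count≡2⇒other-unique (_≟ lookup v j) v (iv (lookup v j))
        (partner-swap0≢ v iv vⱼ≢v₀) (partner-swap0≢ v iv vⱼ′≢v₀ ∘ trans (sym p≡p′))
        (lookup-partner-swap0 v iv vⱼ≢v₀) refl vⱼ′≡vⱼ))
    where
    vⱼ′≡vⱼ : lookup v j′ ≡ lookup v j
    vⱼ′≡vⱼ = begin
      lookup v j′                      ≡⟨ lookup-partner-swap0 v iv vⱼ′≢v₀ ⟨
      lookup v (partner (swap0 v j′))  ≡⟨ cong (lookup v) p≡p′ ⟨
      lookup v (partner (swap0 v j))   ≡⟨ lookup-partner-swap0 v iv vⱼ≢v₀ ⟩
      lookup v j                       ∎

  partner-neighbours-cover : (v : Str m) → IsVertex m v → (c : Color m) → c ≢ zero →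
                             (partner v ≡ c) ⊎ ∃ λ w → IsVertex m w × Adj m v w × partner w ≡ c
  partner-neighbours-cover v iv c c≢0 with lookup v c ≟ lookup v zero
  ... | yes v_c≡v₀ = inj₁ (partner-unique v iv c≢0 v_c≡v₀)
  ... | no v_c≢v₀ with count≡2⇒other (_≟ lookup v c) v (iv (lookup v c)) refl
  ...   | q , q≢c , v_q≡v_c =
    inj₂ (swap0 v q , IsVertex-swap0 v iv q , (q , v_q≢v₀ , refl) ,
          partner-unique (swap0 v q) (IsVertex-swap0 v iv q) c≢0 (begin
            lookup (swap0 v q) c     ≡⟨ lookup∘swap0-other v c≢0 (q≢c ∘ sym) ⟩
            lookup v c               ≡⟨ v_q≡v_c ⟨
            lookup v q               ≡⟨ lookup∘swap0-zero v (moved⇒≢zero v v_q≢v₀) ⟨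
            lookup (swap0 v q) zero  ∎))
    where
    v_q≢v₀ : lookup v q ≢ lookup v zero
    v_q≢v₀ = v_c≢v₀ ∘ trans (sym v_q≡v_c)

  partner-isTotalColoring : IsTotalColoring m partner edgeColour
  partner-isTotalColoring = record
    { edge-well-defined  = λ v w _ _ → edgeColour-symmetric v w
    ; vertex-color-range = partner≢zero
    ; edge-color-range   = λ { v _ _ _ (_ , vⱼ≢v₀ , refl) → moved⇒≢zero v vⱼ≢v₀ }
    ; adjacent-vertices  = λ v _ iv _ → partner-adjacent-≢ v iv
    ; incident-edges     = λ v _ _ _ _ _ a b w≢u → w≢u ∘ edgeColour-injective v a b
    ; edge-endpoint₁     = λ v _ iv _ → edgeColour≢partner-source v iv
    ; edge-endpoint₂     = λ v _ iv _ → edgeColour≢partner-target v iv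
    }

  partner-isEfficient : IsEfficient m partner
  partner-isEfficient = record
    { neighbours-distinct = λ v _ _ iv _ _ → partner-neighbours-≢ v iv
    ; all-colors          = partner-neighbours-cover
    }

theorem12 : (m : ℕ) → 1 < suc m →
    Σ (Str m → Color m) λ vc →
    Σ ((v w : Str m) → Adj m v w → Color m) λ ec →
      IsTotalColoring m vc ec × IsEfficient m vc ×
      (∀ v → IsVertex m v → ∀ i → i ≢ zero → InSigma m i v → vc v ≡ i)
theorem12 m _ =
  partner , edgeColour , partner-isTotalColoring , partner-isEfficient ,
  λ v iv _ i≢0 → partner-unique v iv i≢0
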